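{- Let $\mathcal T$ be a tangle of order $k$ in a connectivity system $(E,\lambda)$, and let $(R,G)$ be a $\mathcal T$-strong $k$-separation of $\lambda$. Then: (i) if $A\subseteq G$ is a non-empty $\mathcal T$-weak set such that $R\cup A$ is $k$-separating and $G-A$ is $\mathcal T$-strong, then $(R,G)$ is $\mathcal T$-equivalent to $(R\cup A,G-A)$; (ii) if $(R,G)$ is non-sequential and $A\subseteq G$ is a non-empty $\mathcal T$-weak set such that $R\cup A$ is $k$-separating, then $(R\cup A,G-A)$ is $\mathcal T$-equivalent to $(R,G)$; (iii) if $(R,G)$ is non-sequential, then $(\mathrm{fcl}_{\mathcal T}(R),E-\mathrm{fcl}_{\mathcal T}(R))$ is $\mathcal T$-equivalent to $(R,G)$; (iv) if $(R,G)$ is non-sequential and $X$ is a $k$-separating set with $E-\mathrm{fcl}_{\mathcal T}(G)\subseteq X\subseteq R$, then $(X,E-X)$ is $\mathcal T$-equivalent to $(R,G)$.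
   Context: A connectivity system is a pair $(E,\lambda)$ with $E$ finite and $\lambda$ an integer-valued symmetric ($\lambda(X)=\lambda(E-X)$) submodular function on subsets of $E$. $X$ is $k$-separating if $\lambda(X)\le k$; a $k$-separation is an unordered partition $(X,E-X)$ (parts may be empty) with $\lambda(X)\le k$. A tangle of order $k$ is a collection $\mathcal T$ of subsets of $E$ with (T1) $\lambda(A)<k$ for $A\in\mathcal T$; (T2) if $\lambda(A)\le k-1$ then $A\in\mathcal T$ or $E-A\in\mathcal T$; (T3) no three members have union $E$; (T4) $E-\{e\}\notin\mathcal T$. $X$ is $\mathcal T$-weak if contained in a member of $\mathcal T$, else $\mathcal T$-strong; a $k$-separation is $\mathcal T$-strong if both sides are. A $\mathcal T$-strong $k$-separating $X$ is fully closed if no non-empty $\mathcal T$-weak $Y\subseteq E-X$ has $X\cup Y$ $k$-separating; $\mathrm{fcl}_{\mathcal T}(X)$ is the intersection of all fully closed $k$-separating sets containing $X$. $\mathcal T$-strong $k$-separations $(X,Y),(X',Y')$ are $\mathcal T$-equivalent if $\{\mathrm{fcl}_{\mathcal T}(X),\mathrm{fcl}_{\mathcal T}(Y)\}=\{\mathrm{fcl}_{\mathcal T}(X'),\mathrm{fcl}_{\mathcal T}(Y')\}$. A $k$-separating set $X$ is $\mathcal T$-sequential if $E-X$ is $\mathcal T$-strong and $\mathrm{fcl}_{\mathcal T}(E-X)=E$; a $k$-separation $(X,Y)$ is non-sequential if neither $X$ nor $Y$ is $\mathcal T$-sequential. -}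

module Defs where

open import Data.Nat using (ℕ)
open import Data.Integer using (ℤ; _+_; _≤_; _<_)
open import Data.Fin using (Fin)
open import Data.Fin.Subset using (Subset; _∈_; _⊆_; ∁; _∩_; _∪_; _─_; ⁅_⁆; ⊤; Nonempty)
open import Data.Product using (Σ; _×_)
open import Data.Sum using (_⊎_)
open import Relation.Nullary using (¬_)
open import Relation.Binary.PropositionalEquality using (_≡_; _≢_)

record ConnectivitySystem : Set where
  field
    n            : ℕ
    conn         : Subset n → ℤ
    symmetric    : ∀ X → conn X ≡ conn (∁ X)
    submodular   : ∀ X Y → conn (X ∪ Y) + conn (X ∩ Y) ≤ conn X + conn Y

module _ (S : ConnectivitySystem) where
  open ConnectivitySystem S

  KSep : ℤ → Subset n → Set
  KSep k X = conn X ≤ k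

  record IsTangle (k : ℤ) (T : Subset n → Set) : Set where
    field
      T1 : ∀ A → T A → conn A < k
      T2 : ∀ A → conn A < k → T A ⊎ T (∁ A)   -- λ(A) ≤ k-1 ⟺ λ(A) < k
      T3 : ∀ A B C → T A → T B → T C → (A ∪ B) ∪ C ≢ ⊤
      T4 : ∀ e → ¬ T (∁ ⁅ e ⁆)

  module _ (k : ℤ) (T : Subset n → Set) where

    Weak : Subset n → Set
    Weak X = Σ (Subset n) λ B → T B × X ⊆ B

    Strong : Subset n → Set
    Strong X = ¬ Weak X

    FullyClosed : Subset n → Set
    FullyClosed X = KSep k X × Strong X ×
      (∀ Y → Y ⊆ ∁ X → Nonempty Y → Weak Y → ¬ KSep k (X ∪ Y))

    -- F is fcl_T(X): the intersection of all fully closed k-separating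
    -- sets containing X (E itself if there are none).
    IsFcl : Subset n → Subset n → Set
    IsFcl X F = ∀ e → (e ∈ F → ∀ Z → FullyClosed Z → X ⊆ Z → e ∈ Z)
                    × ((∀ Z → FullyClosed Z → X ⊆ Z → e ∈ Z) → e ∈ F)

    StrongSep : Subset n → Set
    StrongSep X = KSep k X × Strong X × Strong (∁ X)

    Equiv : Subset n → Subset n → Set
    Equiv X X' = StrongSep X × StrongSep X' ×
      (∀ F₁ F₂ F₁' F₂' → IsFcl X F₁ → IsFcl (∁ X) F₂ →
         IsFcl X' F₁' → IsFcl (∁ X') F₂' →
         (F₁ ≡ F₁' × F₂ ≡ F₂') ⊎ (F₁ ≡ F₂' × F₂ ≡ F₁'))

    Sequential : Subset n → Set
    Sequential X = KSep k X × Strong (∁ X) ×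
      (∀ F → IsFcl (∁ X) F → F ≡ ⊤)

    NonSequential : Subset n → Set
    NonSequential X = ¬ Sequential X × ¬ Sequential (∁ X)

-- Write  InClosure X Y  for "every fully closed k-separating set containing
-- X contains Y", i.e. Y ⊆ fcl(X).  Two separations are T-equivalent as soon
-- as each side lies in the closure of the corresponding other side, so every
-- part reduces to statements of this form.  They all come from one
-- absorption lemma: a fully closed Z containing a strong subset W of a
-- k-separating P contains all of P when P - W is weak.  (Either Z ∩ P is
-- (k-1)-separating, and tangle axiom (T2) forces Z = E; or uncrossing Z and
-- P shows Z ∪ P is k-separating, and full closure absorbs P - Z.)
--
-- Parts (i) and (ii): adjoining a weak A to R changes neither closure;
-- non-sequentiality supplies the strength of G - A needed in (ii).
-- Parts (iii) and (iv): fcl(R) is a maximal set obtained from R by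
-- repeatedly adjoining weak sets (it exists only classically, so we argue
-- under a double negation and conclude by decidability); such a set keeps
-- both closures, and (iv) is (iii) applied to the side G.
module Submission where

open import Defs
open import Data.Integer using (ℤ)
open import Data.Fin.Subset using (Subset; _⊆_; ∁; _∩_; _∪_; Nonempty)
open import Data.Product using (_×_)

open import Data.Nat using (ℕ)
open import Data.Integer using (_+_; _≤_)
open import Data.Integer.Properties
  using (_<?_; _≤?_; ≮⇒≥; <⇒≱; +-mono-<; +-mono-<-≤; +-mono-≤; ≤-trans; module ≤-Reasoning)
open import Data.Fin.Subset using (⊤; ⊥; _⊃_)
open import Data.Fin.Subset.Properties
  using ( _∈?_; ∈⊤; ⊆⊤; ⊆-refl; ⊆-reflexive; ⊆-trans; ⊆-antisym
        ; x∈∁p⇒x∉p; x∉p⇒x∈∁p; p⊆q⇒∁p⊇∁q; p∩q⊆p; p∩q⊆q; x∈p∩q⁺; x∈p∩q⁻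
        ; p⊆p∪q; q⊆p∪q; x∈p∪q⁻; ∪-inverseʳ; ∩-inverseʳ; ∪-distribˡ-∩; ∩-identityʳ
        ; ∪-∩-booleanAlgebra )
open import Data.Fin.Subset.Induction using (⊃-wellFounded)
open import Algebra.Lattice.Properties.BooleanAlgebra as BooleanAlgebraProperties using ()
open import Induction.WellFounded using (Acc; acc)
open import Data.Product using (Σ; _,_; proj₁; proj₂)
open import Data.Sum using (_⊎_; inj₁; inj₂; [_,_])
open import Relation.Nullary using (¬_; yes; no)
open import Relation.Nullary.Negation using (contradiction; ¬¬-map)
open import Relation.Nullary.Decidable using (decidable-stable)
open import Relation.Binary.PropositionalEquality
  using (_≡_; sym; trans; subst; cong; cong₂; module ≡-Reasoning)

+-cancel-≤ : ∀ {a b c d : ℤ} → a + c ≤ b + d → d ≤ c → a ≤ b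
+-cancel-≤ {a} {b} a+c≤b+d d≤c with b <? a
... | yes b<a = contradiction a+c≤b+d (<⇒≱ (+-mono-<-≤ b<a d≤c))
... | no  b≮a = ≮⇒≥ b≮a

halve-≤ : ∀ {a b : ℤ} → a + a ≤ b + b → a ≤ b
halve-≤ {a} {b} a+a≤b+b with b <? a
... | yes b<a = contradiction a+a≤b+b (<⇒≱ (+-mono-< b<a b<a))
... | no  b≮a = ≮⇒≥ b≮a

module _ {n : ℕ} where

  ∪-outside-part : (Z P : Subset n) → Z ∪ (P ∩ ∁ Z) ≡ Z ∪ P
  ∪-outside-part Z P = begin
    Z ∪ (P ∩ ∁ Z)        ≡⟨ ∪-distribˡ-∩ Z P (∁ Z) ⟩
    (Z ∪ P) ∩ (Z ∪ ∁ Z)  ≡⟨ cong ((Z ∪ P) ∩_) (∪-inverseʳ Z) ⟩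
    (Z ∪ P) ∩ ⊤          ≡⟨ ∩-identityʳ (Z ∪ P) ⟩
    Z ∪ P                ∎
    where open ≡-Reasoning

  outside-part-⊆ : {P W Y Z : Subset n} → P ⊆ W ∪ Y → W ⊆ Z → P ∩ ∁ Z ⊆ Y
  outside-part-⊆ {P} {W} {Y} {Z} P⊆W∪Y W⊆Z x∈P∖Z
    with x∈p∩q⁻ P (∁ Z) x∈P∖Z
  ... | x∈P , x∈∁Z with x∈p∪q⁻ W Y (P⊆W∪Y x∈P)
  ...   | inj₁ x∈W = contradiction (W⊆Z x∈W) (x∈∁p⇒x∉p x∈∁Z)
  ...   | inj₂ x∈Y = x∈Y

  complement-cover : {X Y : Subset n} → ∁ X ⊆ ∁ (X ∪ Y) ∪ Y
  complement-cover {X} {Y} {x} x∈∁X with x ∈? Y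
  ... | yes x∈Y = q⊆p∪q (∁ (X ∪ Y)) Y x∈Y
  ... | no  x∉Y = p⊆p∪q Y (x∉p⇒x∈∁p λ x∈X∪Y →
                    [ x∈∁p⇒x∉p x∈∁X , x∉Y ] (x∈p∪q⁻ X Y x∈X∪Y))

module FullClosure (S : ConnectivitySystem) (k : ℤ)
  (T : Subset (ConnectivitySystem.n S) → Set) (tangle : IsTangle S k T) where
  open ConnectivitySystem S
  open IsTangle tangle using (T2)
  open BooleanAlgebraProperties (∪-∩-booleanAlgebra n)
    using (¬-involutive; ¬⊥≈⊤; deMorgan₂)

  KS Wk St FC SS Seq : Subset n → Set
  KS  = KSep S k
  Wk  = Weak S k T
  St  = Strong S k T
  FC  = FullyClosed S k T
  SS  = StrongSep S k T
  Seq = Sequential S k T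

  Fcl Eqv : Subset n → Subset n → Set
  Fcl = IsFcl S k T
  Eqv = Equiv S k T

  R⊆∁∁R : ∀ {R} → R ⊆ ∁ (∁ R)
  R⊆∁∁R {R} = ⊆-reflexive (sym (¬-involutive R))

  ∁∁R⊆R : ∀ {R} → ∁ (∁ R) ⊆ R
  ∁∁R⊆R {R} = ⊆-reflexive (¬-involutive R)

  kSep-∁ : ∀ {X} → KS X → KS (∁ X)
  kSep-∁ {X} = subst (_≤ k) (symmetric X)

  -- λ(E) is the least connectivity: 2λ(E) = λ(E) + λ(∅) ≤ λ(X) + λ(E - X) = 2λ(X).
  conn-⊤-least : ∀ X → conn ⊤ ≤ conn X
  conn-⊤-least X = halve-≤ (begin
      conn ⊤ + conn ⊤                  ≡⟨ cong₂ _+_ (cong conn (sym (∪-inverseʳ X))) conn-⊤≡conn-∅ ⟩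
      conn (X ∪ ∁ X) + conn (X ∩ ∁ X)  ≤⟨ submodular X (∁ X) ⟩
      conn X + conn (∁ X)              ≡⟨ cong (conn X +_) (sym (symmetric X)) ⟩
      conn X + conn X                  ∎)
    where
      open ≤-Reasoning
      conn-⊤≡conn-∅ : conn ⊤ ≡ conn (X ∩ ∁ X)
      conn-⊤≡conn-∅ = trans (cong conn (sym ¬⊥≈⊤))
                        (trans (sym (symmetric ⊥)) (cong conn (sym (∩-inverseʳ X))))

  union-kSep : ∀ {X Y} → KS X → KS Y → k ≤ conn (X ∩ Y) → KS (X ∪ Y)
  union-kSep {X} {Y} ksX ksY k≤conn =
    +-cancel-≤ (≤-trans (submodular X Y) (+-mono-≤ ksX ksY)) k≤conn

  weak-⊆ : ∀ {X Y} → X ⊆ Y → Wk Y → Wk X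
  weak-⊆ X⊆Y (B , B∈T , Y⊆B) = B , B∈T , ⊆-trans X⊆Y Y⊆B

  strong-⊇ : ∀ {X Y} → X ⊆ Y → St X → St Y
  strong-⊇ X⊆Y sX wY = sX (weak-⊆ X⊆Y wY)

  member-weak : ∀ {A} → T A → Wk A
  member-weak A∈T = _ , A∈T , ⊆-refl

  -- A fully closed set with weak complement is E: adjoining its complement
  -- would give E, which is k-separating.
  fullyClosed-weak-complement : ∀ {Z} → FC Z → Wk (∁ Z) → ⊤ ⊆ Z
  fullyClosed-weak-complement {Z} (ksZ , _ , closed) w {x} _ with x ∈? Z
  ... | yes x∈Z = x∈Z
  ... | no  x∉Z = contradiction
        (subst KS (sym (∪-inverseʳ Z)) (≤-trans (conn-⊤-least Z) ksZ))
        (closed (∁ Z) ⊆-refl (x , x∉p⇒x∈∁p x∉Z) w)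

  fullyClosed-absorbs : ∀ {Z P} → FC Z → KS (Z ∪ P) → Wk (P ∩ ∁ Z) → P ⊆ Z
  fullyClosed-absorbs {Z} {P} (_ , _ , closed) ksZ∪P w {x} x∈P with x ∈? Z
  ... | yes x∈Z = x∈Z
  ... | no  x∉Z = contradiction
        (subst KS (sym (∪-outside-part Z P)) ksZ∪P)
        (closed (P ∩ ∁ Z) (p∩q⊆q P (∁ Z)) (x , x∈p∩q⁺ (x∈P , x∉p⇒x∈∁p x∉Z)) w)

  absorb : ∀ {Z P W Y} → FC Z → KS P → St W → W ⊆ Z → W ⊆ P → Wk Y → P ⊆ W ∪ Y → P ⊆ Z
  absorb {Z} {P} fcZ@(ksZ , _ , _) ksP sW W⊆Z W⊆P wY P⊆W∪Y with conn (Z ∩ P) <? k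
  ... | no large = fullyClosed-absorbs fcZ (union-kSep ksZ ksP (≮⇒≥ large))
                     (weak-⊆ (outside-part-⊆ P⊆W∪Y W⊆Z) wY)
  ... | yes small with T2 (Z ∩ P) small
  ...   | inj₁ Z∩P∈T = contradiction
          (weak-⊆ (λ x∈W → x∈p∩q⁺ (W⊆Z x∈W , W⊆P x∈W)) (member-weak Z∩P∈T)) sW
  ...   | inj₂ ∁Z∩P∈T = λ _ → fullyClosed-weak-complement fcZ
          (weak-⊆ (p⊆q⇒∁p⊇∁q (p∩q⊆p Z P)) (member-weak ∁Z∩P∈T)) ∈⊤

  InClosure : Subset n → Subset n → Set
  InClosure X Y = ∀ Z → FC Z → X ⊆ Z → Y ⊆ Z

  inClosure-⊆ : ∀ {X Y} → Y ⊆ X → InClosure X Y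
  inClosure-⊆ Y⊆X _ _ X⊆Z = ⊆-trans Y⊆X X⊆Z

  inClosure-trans : ∀ {X Y W} → InClosure X Y → InClosure Y W → InClosure X W
  inClosure-trans XY YW Z fcZ X⊆Z = YW Z fcZ (XY Z fcZ X⊆Z)

  fcl-inClosure : ∀ {X F} → Fcl X F → InClosure X F
  fcl-inClosure hF Z fcZ X⊆Z {e} e∈F = proj₁ (hF e) e∈F Z fcZ X⊆Z

  inClosure⇒⊆fcl : ∀ {X Y F} → Fcl X F → InClosure X Y → Y ⊆ F
  inClosure⇒⊆fcl hF XY {e} e∈Y = proj₂ (hF e) (λ Z fcZ X⊆Z → XY Z fcZ X⊆Z e∈Y)

  fcl-⊇ : ∀ {X F} → Fcl X F → X ⊆ F
  fcl-⊇ hF = inClosure⇒⊆fcl hF (inClosure-⊆ ⊆-refl)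

  fcl-cong : ∀ {X Y F F'} → InClosure X Y → InClosure Y X → Fcl X F → Fcl Y F' → F ≡ F'
  fcl-cong XY YX hF hF' =
    ⊆-antisym (inClosure⇒⊆fcl hF' (inClosure-trans YX (fcl-inClosure hF)))
              (inClosure⇒⊆fcl hF (inClosure-trans XY (fcl-inClosure hF')))

  equiv-intro : ∀ {X Y} → SS X → SS Y → InClosure X Y → InClosure Y X →
    InClosure (∁ X) (∁ Y) → InClosure (∁ Y) (∁ X) → Eqv X Y
  equiv-intro sepX sepY XY YX ∁X∁Y ∁Y∁X = sepX , sepY ,
    λ _ _ _ _ hX h∁X hY h∁Y → inj₁ (fcl-cong XY YX hX hY , fcl-cong ∁X∁Y ∁Y∁X h∁X h∁Y)

  equiv-sym : ∀ {X Y} → Eqv X Y → Eqv Y X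
  equiv-sym (sepX , sepY , same) = sepY , sepX ,
    λ F₁ F₂ F₁' F₂' h₁ h₂ h₁' h₂' → swap (same F₁' F₂' F₁ F₂ h₁' h₂' h₁ h₂)
    where
      swap : ∀ {A B C D : Subset n} → (A ≡ C × B ≡ D) ⊎ (A ≡ D × B ≡ C) →
             (C ≡ A × D ≡ B) ⊎ (C ≡ B × D ≡ A)
      swap (inj₁ (A≡C , B≡D)) = inj₁ (sym A≡C , sym B≡D)
      swap (inj₂ (A≡D , B≡C)) = inj₂ (sym B≡C , sym A≡D)

  sequential-complement : ∀ {R} → SS R → InClosure R ⊤ → Seq (∁ R)
  sequential-complement {R} (ksR , sR , _) R⊤ =
    kSep-∁ ksR , strong-⊇ R⊆∁∁R sR ,
    λ F hF → ⊆-antisym ⊆⊤ (inClosure⇒⊆fcl hF (inClosure-trans (inClosure-⊆ R⊆∁∁R) R⊤))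

  -- When E - R is not sequential, everything in the closure of R has a strong
  -- complement: if E - X were weak, every fully closed Z ⊇ R would contain X
  -- and so be E.
  closure-complement-strong : ∀ {R X} → SS R → ¬ Seq (∁ R) → InClosure R X → St (∁ X)
  closure-complement-strong sepR nonseq RX w = nonseq (sequential-complement sepR
    λ Z fcZ R⊆Z → fullyClosed-weak-complement fcZ (weak-⊆ (p⊆q⇒∁p⊇∁q (RX Z fcZ R⊆Z)) w))

  union-inClosure : ∀ {X Y} → St X → Wk Y → KS (X ∪ Y) → InClosure X (X ∪ Y)
  union-inClosure {X} {Y} sX wY ksX∪Y Z fcZ X⊆Z =
    absorb fcZ ksX∪Y sX X⊆Z (p⊆p∪q Y) wY ⊆-refl

  complement-inClosure : ∀ {X Y} → KS X → Wk Y → St (∁ (X ∪ Y)) → InClosure (∁ (X ∪ Y)) (∁ X)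
  complement-inClosure {X} {Y} ksX wY s Z fcZ ∁X∪Y⊆Z =
    absorb fcZ (kSep-∁ ksX) s ∁X∪Y⊆Z (p⊆q⇒∁p⊇∁q (p⊆p∪q Y)) wY complement-cover

  adjoin-weak-equiv : ∀ {R A} → SS R → Wk A → KS (R ∪ A) → St (∁ (R ∪ A)) → Eqv R (R ∪ A)
  adjoin-weak-equiv {R} {A} sepR@(ksR , sR , _) wA ksR∪A s∁R∪A =
    equiv-intro sepR (ksR∪A , strong-⊇ (p⊆p∪q A) sR , s∁R∪A)
      (union-inClosure sR wA ksR∪A) (inClosure-⊆ (p⊆p∪q A))
      (inClosure-⊆ (p⊆q⇒∁p⊇∁q (p⊆p∪q A))) (complement-inClosure ksR wA s∁R∪A)

  -- The full closure of R when E - R is not sequential: it is a maximal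
  -- extension of R by weak sets, hence shares both closures with R.
  module Saturation (R : Subset n) (sepR : SS R) (nonseq : ¬ Seq (∁ R)) where

    sR : St R
    sR = proj₁ (proj₂ sepR)

    record Extension (X : Subset n) : Set where
      field
        kSep        : KS X
        contains    : R ⊆ X
        closureUp   : InClosure R X
        closureDown : InClosure (∁ X) (∁ R)
    open Extension

    complement-strong : ∀ {X} → Extension X → St (∁ X)
    complement-strong e = closure-complement-strong sepR nonseq (closureUp e)

    extend : ∀ {X Y} → Extension X → Wk Y → KS (X ∪ Y) → Extension (X ∪ Y)
    extend {X} {Y} e wY ksX∪Y = record
      { kSep        = ksX∪Y
      ; contains    = ⊆-trans (contains e) (p⊆p∪q Y)
      ; closureUp   = up
      ; closureDown = inClosure-trans
          (complement-inClosure (kSep e) wY (closure-complement-strong sepR nonseq up))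
          (closureDown e)
      }
      where
        up : InClosure R (X ∪ Y)
        up = inClosure-trans (closureUp e) (union-inClosure (strong-⊇ (contains e) sR) wY ksX∪Y)

    Saturated : Subset n → Set
    Saturated X = ∀ Y → Y ⊆ ∁ X → Nonempty Y → Wk Y → ¬ KS (X ∪ Y)

    MaximalExtension : Set
    MaximalExtension = Σ (Subset n) λ C → Extension C × Saturated C

    saturate : ∀ X → Acc _⊃_ X → Extension X → ¬ ¬ MaximalExtension
    saturate X (acc larger) e noMaximal = noMaximal (X , e , saturated)
      where
        saturated : Saturated X
        saturated Y Y⊆∁X (y , y∈Y) wY ksX∪Y =
          saturate (X ∪ Y) (larger (p⊆p∪q Y , y , q⊆p∪q X Y y∈Y , x∈∁p⇒x∉p (Y⊆∁X y∈Y)))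
                   (extend e wY ksX∪Y) noMaximal

    maximal-extension : ¬ ¬ MaximalExtension
    maximal-extension = saturate R (⊃-wellFounded R)
      record { kSep = proj₁ sepR ; contains = ⊆-refl
             ; closureUp = inClosure-⊆ ⊆-refl ; closureDown = inClosure-⊆ ⊆-refl }

    -- A maximal extension is fully closed and lies in the closure of R,
    -- so it is the full closure of R.
    module _ {F : Subset n} (hF : Fcl R F) where

      maximal-is-fcl : ((C , _ , _) : MaximalExtension) → F ≡ C
      maximal-is-fcl (C , e , saturated) =
        ⊆-antisym (fcl-inClosure hF C (kSep e , strong-⊇ (contains e) sR , saturated) (contains e))
                  (inClosure⇒⊆fcl hF (closureUp e))

      fcl-extension : ¬ ¬ Extension F
      fcl-extension = ¬¬-map (λ m → subst Extension (sym (maximal-is-fcl m)) (proj₁ (proj₂ m)))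
                             maximal-extension

      -- The properties of the extension F needed below are all stable under
      -- double negation.
      fcl-kSep : KS F
      fcl-kSep = decidable-stable (conn F ≤? k) (¬¬-map kSep fcl-extension)

      fcl-complement-strong : St (∁ F)
      fcl-complement-strong w = fcl-extension λ e → complement-strong e w

      fcl-complement-inClosure : InClosure (∁ F) (∁ R)
      fcl-complement-inClosure Z fcZ ∁F⊆Z {x} x∈∁R =
        decidable-stable (x ∈? Z) (¬¬-map (λ e → closureDown e Z fcZ ∁F⊆Z x∈∁R) fcl-extension)

  fcl-equiv : ∀ {R F} → SS R → ¬ Seq (∁ R) → Fcl R F → Eqv F R
  fcl-equiv {R} sepR nonseq hF =
    equiv-intro (fcl-kSep hF , strong-⊇ (fcl-⊇ hF) sR , fcl-complement-strong hF) sepR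
      (inClosure-⊆ (fcl-⊇ hF)) (fcl-inClosure hF)
      (fcl-complement-inClosure hF) (inClosure-⊆ (p⊆q⇒∁p⊇∁q (fcl-⊇ hF)))
    where open Saturation R sepR nonseq

  between-equiv : ∀ {R X FG} → SS R → ¬ Seq R → Fcl (∁ R) FG →
    KS X → ∁ FG ⊆ X → X ⊆ R → Eqv X R
  between-equiv {R} {X} sepR@(ksR , sR , sG) nonseqR hFG ksX ∁FG⊆X X⊆R =
    equiv-intro (ksX , strong-⊇ ∁FG⊆X (fcl-complement-strong hFG) , strong-⊇ ∁R⊆∁X sG) sepR
      (inClosure-trans (inClosure-⊆ ∁FG⊆X)
        (inClosure-trans (fcl-complement-inClosure hFG) (inClosure-⊆ R⊆∁∁R)))
      (inClosure-⊆ X⊆R) (inClosure-⊆ ∁R⊆∁X)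
      (inClosure-trans (fcl-inClosure hFG) (inClosure-⊆ (⊆-trans (p⊆q⇒∁p⊇∁q ∁FG⊆X) ∁∁R⊆R)))
    where
      ∁R⊆∁X : ∁ R ⊆ ∁ X
      ∁R⊆∁X = p⊆q⇒∁p⊇∁q X⊆R
      sepG : SS (∁ R)
      sepG = kSep-∁ ksR , sG , strong-⊇ R⊆∁∁R sR
      open Saturation (∁ R) sepG (λ seq → nonseqR (subst Seq (¬-involutive R) seq))

lemma3p8 : (S : ConnectivitySystem) (k : ℤ)
    (T : Subset (ConnectivitySystem.n S) → Set) → IsTangle S k T →
    (R : Subset (ConnectivitySystem.n S)) → StrongSep S k T R →
    let G = ∁ R in
    (∀ A → A ⊆ G → Nonempty A → Weak S k T A → KSep S k (R ∪ A) →
       Strong S k T (G ∩ ∁ A) → Equiv S k T R (R ∪ A))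
    × (NonSequential S k T R → ∀ A → A ⊆ G → Nonempty A → Weak S k T A →
       KSep S k (R ∪ A) → Equiv S k T (R ∪ A) R)
    × (NonSequential S k T R → ∀ F → IsFcl S k T R F → Equiv S k T F R)
    × (NonSequential S k T R → ∀ X → KSep S k X → ∀ FG → IsFcl S k T G FG →
       ∁ FG ⊆ X → X ⊆ R → Equiv S k T X R)
lemma3p8 S k T tangle R sepR@(_ , sR , _) =
  (λ A _ _ wA ksR∪A sG∖A →
     adjoin-weak-equiv sepR wA ksR∪A (subst St (sym (deMorgan₂ R A)) sG∖A)) ,
  -- (ii) G - A is strong because G is not sequential.
  (λ (_ , nonseqG) A _ _ wA ksR∪A →
     equiv-sym (adjoin-weak-equiv sepR wA ksR∪A
       (closure-complement-strong sepR nonseqG (union-inClosure sR wA ksR∪A)))) ,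
  (λ (_ , nonseqG) F hF → fcl-equiv sepR nonseqG hF) ,
  (λ (nonseqR , _) X ksX FG hFG ∁FG⊆X X⊆R → between-equiv sepR nonseqR hFG ksX ∁FG⊆X X⊆R)
  where
    open FullClosure S k T tangle
    open BooleanAlgebraProperties (∪-∩-booleanAlgebra (ConnectivitySystem.n S)) using (deMorgan₂)
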